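{- Let $B(t,q)=\sum_{n\ge1}P_{2n}(x,0,q)\frac{t^{2n}}{(2n)!_q}$ and $C(t,q)=\sum_{n\ge1}P_{2n-1}(x,0,q)\frac{t^{2n-1}}{(2n-1)!_q}$. Then $$\sum_{n\geq1}P_{2n}(x,y,q)\frac{t^{2n}}{(2n)!_q}=\frac{B(t,q)}{1-yB(t,q)},\qquad \sum_{n\geq1}P_{2n-1}(x,y,q)\frac{t^{2n-1}}{(2n-1)!_q}=\frac{C(t,q)}{1-yB(t,q)}.$$
   Context: $n!_q=\prod_{i=1}^n(1+q+\cdots+q^{i-1})$. For $\sigma\in\mathfrak{S}_n$, $D(\sigma)=\{i\in[n-1]:\sigma(i)>\sigma(i+1)\}$ and $\mathrm{inv}\,\sigma=|\{(i,j):1\le i<j\le n,\ \sigma(i)>\sigma(j)\}|$. For $S\subseteq[n-1]$, $\alpha_n(S,q)=\sum_{\sigma\in\mathfrak{S}_n,\ D(\sigma)\subseteq S}q^{\mathrm{inv}\,\sigma}$, $S_o,S_e$ are the sets of odd, resp. even, elements of $S$, and $P_n(x,y,q)=\sum_{S\subseteq[n-1]}\alpha_n(S,q)x^{|S_o|}y^{|S_e|}$. Identities are of formal power series in $t$. -}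

module Defs where

open import Algebra.Bundles using (CommutativeRing)
open import Data.Nat using (ℕ; zero; suc; _∸_; _<ᵇ_) renaming (_+_ to _+ℕ_)
open import Data.Bool using (Bool; true; false; if_then_else_; _∧_; _∨_; not)
open import Data.List using (List; []; _∷_; _++_; map; concatMap; upTo)

-- A permutation σ ∈ 𝔖_n is represented by its one-line word
-- [σ(1), …, σ(n)], written with the letters 0,…,n-1 (a relabelling
-- that changes neither descents nor inversions).

insertAll : ℕ → List ℕ → List (List ℕ)
insertAll a [] = (a ∷ []) ∷ []
insertAll a (b ∷ bs) = (a ∷ b ∷ bs) ∷ map (b ∷_) (insertAll a bs)

perms : ℕ → List (List ℕ)
perms zero = [] ∷ []
perms (suc n) = concatMap (insertAll n) (perms n)

countSmaller : ℕ → List ℕ → ℕ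
countSmaller a [] = 0
countSmaller a (b ∷ bs) = (if b <ᵇ a then 1 else 0) +ℕ countSmaller a bs

invCount : List ℕ → ℕ
invCount [] = 0
invCount (a ∷ as) = countSmaller a as +ℕ invCount as

-- A subset S ⊆ [n-1] is a Bool list of length n-1; entry i (1-indexed)
-- says whether i ∈ S.

descSet : List ℕ → List Bool
descSet (a ∷ b ∷ r) = (b <ᵇ a) ∷ descSet (b ∷ r)
descSet _ = []

subsets : ℕ → List (List Bool)
subsets zero = [] ∷ []
subsets (suc k) = map (true ∷_) (subsets k) ++ map (false ∷_) (subsets k)

-- inclusion test (used only for lists of equal length)
_⊆ᵇ_ : List Bool → List Bool → Bool
(a ∷ as) ⊆ᵇ (b ∷ bs) = (not a ∨ b) ∧ (as ⊆ᵇ bs)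
_ ⊆ᵇ _ = true

oddCount evenCount : List Bool → ℕ
oddCount [] = 0
oddCount (b ∷ bs) = (if b then 1 else 0) +ℕ evenCount bs
evenCount [] = 0
evenCount (b ∷ bs) = oddCount bs

isEvenᵇ : ℕ → Bool
isEvenᵇ zero = true
isEvenᵇ (suc n) = not (isEvenᵇ n)

module _ {c ℓ} (R : CommutativeRing c ℓ) where
  open CommutativeRing R

  pow : Carrier → ℕ → Carrier
  pow a zero = 1#
  pow a (suc k) = a * pow a k

  sumL : List Carrier → Carrier
  sumL [] = 0#
  sumL (a ∷ as) = a + sumL as

  alpha : ℕ → List Bool → Carrier → Carrier
  alpha n S q =
    sumL (map (λ σ → if descSet σ ⊆ᵇ S then pow q (invCount σ) else 0#) (perms n))

  Ppoly : ℕ → Carrier → Carrier → Carrier → Carrier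
  Ppoly n x y q =
    sumL (map (λ S → alpha n S q * pow x (oddCount S) * pow y (evenCount S))
              (subsets (n ∸ 1)))

  qint : Carrier → ℕ → Carrier
  qint q i = sumL (map (pow q) (upTo i))

  qfact : Carrier → ℕ → Carrier
  qfact q zero = 1#
  qfact q (suc n) = qfact q n * qint q (suc n)

  -- formal power series in t: coefficient sequences
  Series : Set c
  Series = ℕ → Carrier

  _≋_ : Series → Series → Set ℓ
  F ≋ G = ∀ m → F m ≈ G m

  oneS : Series
  oneS zero = 1#
  oneS (suc m) = 0#

  scaleS : Carrier → Series → Series
  scaleS a F m = a * F m

  _⋆_ : Series → Series → Series
  (F ⋆ G) m = sumL (map (λ k → F k * G (m ∸ k)) (upTo (suc m)))

  powS : Series → ℕ → Series
  powS F zero = oneS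
  powS F (suc k) = F ⋆ powS F k

  -- 1/(1 - F) = Σ_k F^k, for F with zero constant term (then the
  -- coefficient of t^m only receives contributions from k ≤ m)
  invOneMinus : Series → Series
  invOneMinus F m = sumL (map (λ k → powS F k m) (upTo (suc m)))

  -- Σ_{n≥1} P_{2n}(x,y,q) t^{2n}/(2n)!_q, where ι m = 1/(m!_q)
  evenGF : Carrier → Carrier → Carrier → (ℕ → Carrier) → Series
  evenGF x y q ι m =
    if isEvenᵇ m ∧ (0 <ᵇ m) then Ppoly m x y q * ι m else 0#

  oddGF : Carrier → Carrier → Carrier → (ℕ → Carrier) → Series
  oddGF x y q ι m =
    if not (isEvenᵇ m) then Ppoly m x y q * ι m else 0#

{-# OPTIONS --safe #-}
module Submission where

-- In a permutation of [n+1] with descents in S, the largest letter ends one of the blocks of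
-- consecutive positions that S cuts [n+1] into; removing it shrinks that block by one and
-- loses one inversion per later letter. By induction α_n(S,q) = n!_q / ∏_B |B|!_q, so
-- P_n(x,y,q)/n!_q = Σ_S x^|S_o| y^|S_e| ∏_B 1/|B|!_q. Cutting S at its first even element,
-- where a block ends, turns the even and the odd part F_y of the generating function into
-- solutions of F_y = F_0 + y B F_y, with B the even part at y = 0. As y B has no constant
-- term, this linear equation determines F_y, and F_0 / (1 - y B) solves it.

open import Defs
open import Algebra.Bundles using (CommutativeRing)
open import Data.Nat using (ℕ)
open import Data.Product using (_×_)

open import Data.Nat using (zero; suc; pred; _∸_; _<ᵇ_; _≤_; _<_; z≤n; s≤s) renaming (_+_ to _+ℕ_)
import Data.Nat.Properties as ℕ
open import Data.Nat.Induction using (<-rec)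
open import Data.Bool using (Bool; true; false; if_then_else_; _∧_; _∨_; not)
open import Data.List using (List; []; _∷_; _++_; map; concatMap; upTo; applyUpTo; length)
import Data.List.Properties as List
open import Data.Product using (_,_)
open import Data.List.Relation.Unary.All as All using (All; []; _∷_)
import Data.List.Relation.Unary.All.Properties as All
open import Data.Bool.Properties using (∨-zeroʳ; ∧-identityʳ; not-involutive; ∧-commutativeMonoid)
open import Algebra.Bundles using (CommutativeMonoid)
import Algebra.Properties.CommutativeSemigroup as CommSemigroupProps
module ℕ+ = CommSemigroupProps ℕ.+-commutativeSemigroup
module Bool∧ = CommSemigroupProps (CommutativeMonoid.commutativeSemigroup ∧-commutativeMonoid)
open import Function using (_∘_)
open import Relation.Binary.PropositionalEquality as ≡ using (_≡_)

-- Inserting the largest letter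

<⇒<ᵇ≡true : ∀ {m n} → m < n → (m <ᵇ n) ≡ true
<⇒<ᵇ≡true {zero}  {suc n} _         = ≡.refl
<⇒<ᵇ≡true {suc m} {suc n} (s≤s m<n) = <⇒<ᵇ≡true m<n

>⇒<ᵇ≡false : ∀ {m n} → n < m → (m <ᵇ n) ≡ false
>⇒<ᵇ≡false {suc m} {zero}  _         = ≡.refl
>⇒<ᵇ≡false {suc m} {suc n} (s≤s n<m) = >⇒<ᵇ≡false n<m

insertAt : ℕ → ℕ → List ℕ → List ℕ
insertAt zero    a σ       = a ∷ σ
insertAt (suc j) a []      = a ∷ []
insertAt (suc j) a (b ∷ σ) = b ∷ insertAt j a σ

insertAll-insertAt : ∀ a σ → insertAll a σ ≡ applyUpTo (λ j → insertAt j a σ) (suc (length σ))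
insertAll-insertAt a []      = ≡.refl
insertAll-insertAt a (b ∷ σ) = ≡.cong ((a ∷ b ∷ σ) ∷_) (≡.trans
  (≡.cong (map (b ∷_)) (insertAll-insertAt a σ))
  (List.map-applyUpTo (λ j → insertAt j a σ) (b ∷_) (suc (length σ))))

Word : ℕ → List ℕ → Set
Word n σ = length σ ≡ n × All (_< n) σ

insertAll-words : ∀ a σ → All (_< suc a) σ →
                  All (λ τ → length τ ≡ suc (length σ) × All (_< suc a) τ) (insertAll a σ)
insertAll-words a []      []          = (≡.refl , ℕ.≤-refl ∷ []) ∷ []
insertAll-words a (b ∷ σ) (b<a ∷ σ<a) = (≡.refl , ℕ.≤-refl ∷ b<a ∷ σ<a) ∷
  All.map⁺ (All.map (λ (len , τ<a) → ≡.cong suc len , b<a ∷ τ<a) (insertAll-words a σ σ<a))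

perms-words : ∀ n → All (Word n) (perms n)
perms-words zero    = (≡.refl , []) ∷ []
perms-words (suc n) = All.concat⁺ (All.map⁺ (All.map (λ {σ} (len , σ<n) →
    All.map (λ (len′ , τ<) → ≡.trans len′ (≡.cong suc len) , τ<)
            (insertAll-words n σ (All.map ℕ.m<n⇒m<1+n σ<n)))
  (perms-words n)))

countSmaller-all : ∀ a σ → All (_< a) σ → countSmaller a σ ≡ length σ
countSmaller-all a []      []          = ≡.refl
countSmaller-all a (b ∷ σ) (b<a ∷ σ<a) rewrite <⇒<ᵇ≡true b<a = ≡.cong suc (countSmaller-all a σ σ<a)

countSmaller-insertAt : ∀ j {a b} σ → b < a → countSmaller b (insertAt j a σ) ≡ countSmaller b σ
countSmaller-insertAt zero    σ       b<a rewrite >⇒<ᵇ≡false b<a = ≡.refl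
countSmaller-insertAt (suc j) []      b<a rewrite >⇒<ᵇ≡false b<a = ≡.refl
countSmaller-insertAt (suc j) {b = b} (c ∷ σ) b<a =
  ≡.cong ((if c <ᵇ b then 1 else 0) +ℕ_) (countSmaller-insertAt j σ b<a)

invCount-insertAt : ∀ j a σ → All (_< a) σ → j ≤ length σ →
                    invCount (insertAt j a σ) ≡ (length σ ∸ j) +ℕ invCount σ
invCount-insertAt zero    a σ       σ<a         _         = ≡.cong (_+ℕ invCount σ) (countSmaller-all a σ σ<a)
invCount-insertAt (suc j) a (b ∷ σ) (b<a ∷ σ<a) (s≤s j≤n) = begin
  countSmaller b (insertAt j a σ) +ℕ invCount (insertAt j a σ)
    ≡⟨ ≡.cong₂ _+ℕ_ (countSmaller-insertAt j σ b<a) (invCount-insertAt j a σ σ<a j≤n) ⟩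
  countSmaller b σ +ℕ ((length σ ∸ j) +ℕ invCount σ)
    ≡⟨ ℕ+.x∙yz≈y∙xz (countSmaller b σ) (length σ ∸ j) (invCount σ) ⟩
  (length σ ∸ j) +ℕ (countSmaller b σ +ℕ invCount σ) ∎
  where open ≡.≡-Reasoning

-- Whether the letter at position j (from 0) of a word of length |S| + 1 may exceed its
-- successor: j + 1 ∈ S, or it has none.
isBlockEnd : ℕ → List Bool → Bool
isBlockEnd zero    []      = true
isBlockEnd zero    (s ∷ _) = s
isBlockEnd (suc j) []      = false
isBlockEnd (suc j) (_ ∷ S) = isBlockEnd j S

-- The descent condition left on σ when the largest letter sits at position j of
-- insertAt j a σ: the pair of letters it separates becomes unconstrained.
contract : ℕ → List Bool → List Bool
contract zero          []          = []
contract zero          (_ ∷ S)     = S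
contract (suc zero)    []          = []
contract (suc zero)    (_ ∷ [])    = []
contract (suc zero)    (_ ∷ _ ∷ S) = true ∷ S
contract (suc (suc j)) []          = []
contract (suc (suc j)) (s ∷ S)     = s ∷ contract (suc j) S

length-contract : ∀ j S → j ≤ length S → length (contract j S) ≡ pred (length S)
length-contract zero          []          _         = ≡.refl
length-contract zero          (_ ∷ S)     _         = ≡.refl
length-contract (suc zero)    (_ ∷ [])    _         = ≡.refl
length-contract (suc zero)    (_ ∷ _ ∷ S) _         = ≡.refl
length-contract (suc (suc j)) (_ ∷ [])    (s≤s ())
length-contract (suc (suc j)) (_ ∷ t ∷ S) (s≤s j≤n) = ≡.cong suc (length-contract (suc j) (t ∷ S) j≤n)

descSet-insertAt : ∀ j a σ S → All (_< a) σ → length σ ≡ length S → j ≤ length σ →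
                   (descSet (insertAt j a σ) ⊆ᵇ S) ≡ isBlockEnd j S ∧ (descSet σ ⊆ᵇ contract j S)
descSet-insertAt zero          a []          []          _               _   _ = ≡.refl
descSet-insertAt zero          a (b ∷ σ)     (s ∷ S)     (b<a ∷ _)       _   _ rewrite <⇒<ᵇ≡true b<a = ≡.refl
descSet-insertAt (suc zero)    a (b ∷ [])    (s ∷ [])    (b<a ∷ _)       _   _ rewrite >⇒<ᵇ≡false b<a = ≡.refl
descSet-insertAt (suc zero)    a (b ∷ c ∷ σ) (s ∷ t ∷ S) (b<a ∷ c<a ∷ σ<a) len _
  rewrite >⇒<ᵇ≡false b<a | ∨-zeroʳ (not (c <ᵇ b)) =
  descSet-insertAt zero a (c ∷ σ) (t ∷ S) (c<a ∷ σ<a) (ℕ.suc-injective len) z≤n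
descSet-insertAt (suc (suc j)) a (b ∷ c ∷ σ) (s ∷ t ∷ S) (_ ∷ c<a ∷ σ<a) len (s≤s j≤n) =
  ≡.trans (≡.cong (d ∧_) (descSet-insertAt (suc j) a (c ∷ σ) (t ∷ S) (c<a ∷ σ<a) (ℕ.suc-injective len) j≤n))
          (Bool∧.x∙yz≈y∙xz d (isBlockEnd (suc j) (t ∷ S)) (descSet (c ∷ σ) ⊆ᵇ contract (suc j) (t ∷ S)))
  where
  d : Bool
  d = not (c <ᵇ b) ∨ s
descSet-insertAt (suc (suc j)) a (b ∷ []) _ _ _ (s≤s ())

blockLength : ℕ → ℕ → List Bool → ℕ
blockLength k zero    _           = suc k
blockLength k (suc j) []          = 0
blockLength k (suc j) (true ∷ S)  = blockLength 0 j S
blockLength k (suc j) (false ∷ S) = blockLength (suc k) j S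

hasParity : Bool → ℕ → Bool
hasParity true  m = isEvenᵇ m
hasParity false m = not (isEvenᵇ m)

hasParity-suc : ∀ e m → hasParity e (suc m) ≡ hasParity (not e) m
hasParity-suc true  m = ≡.refl
hasParity-suc false m = not-involutive (isEvenᵇ m)

isEvenᵇ-+-even : ∀ a b → isEvenᵇ a ≡ true → isEvenᵇ (a +ℕ b) ≡ isEvenᵇ b
isEvenᵇ-+-even zero          b _      = ≡.refl
isEvenᵇ-+-even (suc (suc a)) b a-even = ≡.trans (not-involutive (isEvenᵇ (a +ℕ b)))
  (isEvenᵇ-+-even a b (≡.trans (≡.sym (not-involutive (isEvenᵇ a))) a-even))

hasParity-even-shift : ∀ e a b → isEvenᵇ a ≡ true → hasParity e (a +ℕ b) ≡ hasParity e b
hasParity-even-shift true  a b a-even = isEvenᵇ-+-even a b a-even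
hasParity-even-shift false a b a-even = ≡.cong not (isEvenᵇ-+-even a b a-even)

subsets-length : ∀ n → All (λ S → length S ≡ n) (subsets n)
subsets-length zero    = ≡.refl ∷ []
subsets-length (suc n) = All.++⁺ (All.map⁺ (All.map (≡.cong suc) (subsets-length n)))
                                 (All.map⁺ (All.map (≡.cong suc) (subsets-length n)))

module _ {c ℓ} (R : CommutativeRing c ℓ) where
  open CommutativeRing R hiding (zero)
  open import Relation.Binary.Reasoning.Setoid setoid
  open import Algebra.Solver.Ring.NaturalCoefficients.Default commutativeSemiring
    using (solve; _:=_; _:+_; _:*_; con)

  sumL-++ : ∀ xs ys → sumL R (xs ++ ys) ≈ sumL R xs + sumL R ys
  sumL-++ []       ys = sym (+-identityˡ _)
  sumL-++ (x ∷ xs) ys = trans (+-congˡ (sumL-++ xs ys)) (sym (+-assoc _ _ _))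

  module _ {a} {A : Set a} where

    sumL-cong : ∀ (f g : A → Carrier) xs → (∀ x → f x ≈ g x) →
                sumL R (map f xs) ≈ sumL R (map g xs)
    sumL-cong f g []       f≈g = refl
    sumL-cong f g (x ∷ xs) f≈g = +-cong (f≈g x) (sumL-cong f g xs f≈g)

    sumL-congᴬ : ∀ {p} {P : A → Set p} (f g : A → Carrier) {xs} → All P xs →
                 (∀ {x} → P x → f x ≈ g x) → sumL R (map f xs) ≈ sumL R (map g xs)
    sumL-congᴬ f g []         f≈g = refl
    sumL-congᴬ f g (px ∷ pxs) f≈g = +-cong (f≈g px) (sumL-congᴬ f g pxs f≈g)

    sumL-*ˡ : ∀ a (f : A → Carrier) xs → sumL R (map (λ x → a * f x) xs) ≈ a * sumL R (map f xs)
    sumL-*ˡ a f []       = sym (zeroʳ a)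
    sumL-*ˡ a f (x ∷ xs) = trans (+-congˡ (sumL-*ˡ a f xs)) (sym (distribˡ a _ _))

    sumL-*ʳ : ∀ a (f : A → Carrier) xs → sumL R (map (λ x → f x * a) xs) ≈ sumL R (map f xs) * a
    sumL-*ʳ a f xs = begin
      sumL R (map (λ x → f x * a) xs) ≈⟨ sumL-cong _ _ xs (λ x → *-comm (f x) a) ⟩
      sumL R (map (λ x → a * f x) xs) ≈⟨ sumL-*ˡ a f xs ⟩
      a * sumL R (map f xs)           ≈⟨ *-comm a _ ⟩
      sumL R (map f xs) * a           ∎

  sumL-concatMap : ∀ {a b} {A : Set a} {B : Set b} (f : B → Carrier) (g : A → List B) xs →
                   sumL R (map f (concatMap g xs)) ≈ sumL R (map (λ x → sumL R (map f (g x))) xs)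
  sumL-concatMap f g []       = refl
  sumL-concatMap f g (x ∷ xs) = begin
    sumL R (map f (g x ++ concatMap g xs))                ≡⟨ ≡.cong (sumL R) (List.map-++ f (g x) _) ⟩
    sumL R (map f (g x) ++ map f (concatMap g xs))        ≈⟨ sumL-++ (map f (g x)) _ ⟩
    sumL R (map f (g x)) + sumL R (map f (concatMap g xs)) ≈⟨ +-congˡ (sumL-concatMap f g xs) ⟩
    sumL R (map f (g x)) + sumL R (map (λ x → sumL R (map f (g x))) xs) ∎

  -- Opaque, so that the summand of ∑< n f can be inferred by unification.
  opaque
    ∑< : ℕ → (ℕ → Carrier) → Carrier
    ∑< n f = sumL R (applyUpTo f n)

  opaque
    unfolding ∑<

    ∑<-empty : ∀ (f : ℕ → Carrier) → ∑< 0 f ≡ 0#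
    ∑<-empty f = ≡.refl

    ∑<-suc : ∀ n (f : ℕ → Carrier) → ∑< (suc n) f ≡ f 0 + ∑< n (f ∘ suc)
    ∑<-suc n f = ≡.refl

    sumL-applyUpTo : ∀ {a} {A : Set a} n (f : A → Carrier) g → sumL R (map f (applyUpTo g n)) ≡ ∑< n (f ∘ g)
    sumL-applyUpTo n f g = ≡.cong (sumL R) (List.map-applyUpTo g f n)

    ∑<-cong : ∀ n {f g : ℕ → Carrier} → (∀ i → i < n → f i ≈ g i) → ∑< n f ≈ ∑< n g
    ∑<-cong zero    f≈g = refl
    ∑<-cong (suc n) f≈g = +-cong (f≈g 0 (s≤s z≤n)) (∑<-cong n (λ i i<n → f≈g (suc i) (s≤s i<n)))

    ∑<-+ : ∀ n (f g : ℕ → Carrier) → ∑< n (λ i → f i + g i) ≈ ∑< n f + ∑< n g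
    ∑<-+ zero    f g = sym (+-identityˡ _)
    ∑<-+ (suc n) f g = begin
      (f 0 + g 0) + ∑< n (λ i → f (suc i) + g (suc i))
        ≈⟨ +-congˡ (∑<-+ n (f ∘ suc) (g ∘ suc)) ⟩
      (f 0 + g 0) + (∑< n (f ∘ suc) + ∑< n (g ∘ suc))
        ≈⟨ solve 4 (λ a b c d → (a :+ b) :+ (c :+ d) := (a :+ c) :+ (b :+ d)) refl _ _ _ _ ⟩
      (f 0 + ∑< n (f ∘ suc)) + (g 0 + ∑< n (g ∘ suc)) ∎

    ∑<-*ˡ : ∀ n a (f : ℕ → Carrier) → ∑< n (λ i → a * f i) ≈ a * ∑< n f
    ∑<-*ˡ zero    a f = sym (zeroʳ a)
    ∑<-*ˡ (suc n) a f = trans (+-congˡ (∑<-*ˡ n a (f ∘ suc))) (sym (distribˡ a _ _))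

    ∑<-vanishing : ∀ n {f : ℕ → Carrier} → (∀ i → i < n → f i ≈ 0#) → ∑< n f ≈ 0#
    ∑<-vanishing zero    f≈0 = refl
    ∑<-vanishing (suc n) f≈0 =
      trans (+-cong (f≈0 0 (s≤s z≤n)) (∑<-vanishing n (λ i i<n → f≈0 (suc i) (s≤s i<n)))) (+-identityˡ 0#)

    ∑<-last : ∀ n (f : ℕ → Carrier) → ∑< (suc n) f ≈ ∑< n f + f n
    ∑<-last zero    f = trans (+-identityʳ _) (sym (+-identityˡ _))
    ∑<-last (suc n) f = trans (+-congˡ (∑<-last n (f ∘ suc))) (sym (+-assoc _ _ _))

  ∑<-*ʳ : ∀ n a (f : ℕ → Carrier) → ∑< n (λ i → f i * a) ≈ ∑< n f * a
  ∑<-*ʳ n a f = trans (∑<-cong n (λ i _ → *-comm (f i) a)) (trans (∑<-*ˡ n a f) (*-comm a _))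

  sumL-upTo : ∀ n (f : ℕ → Carrier) → sumL R (map f (upTo n)) ≡ ∑< n f
  sumL-upTo n f = sumL-applyUpTo n f (λ i → i)

  ∑<-vanishing-tail : ∀ N d {h : ℕ → Carrier} → (∀ k → N ≤ k → h k ≈ 0#) → ∑< (N +ℕ d) h ≈ ∑< N h
  ∑<-vanishing-tail N zero    {h} h≈0 = reflexive (≡.cong (λ n → ∑< n h) (ℕ.+-identityʳ N))
  ∑<-vanishing-tail N (suc d) {h} h≈0 = begin
    ∑< (N +ℕ suc d) h         ≡⟨ ≡.cong (λ n → ∑< n h) (ℕ.+-suc N d) ⟩
    ∑< (suc (N +ℕ d)) h       ≈⟨ ∑<-last (N +ℕ d) h ⟩
    ∑< (N +ℕ d) h + h (N +ℕ d) ≈⟨ +-cong (∑<-vanishing-tail N d h≈0) (h≈0 (N +ℕ d) (ℕ.m≤m+n N d)) ⟩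
    ∑< N h + 0#               ≈⟨ +-identityʳ _ ⟩
    ∑< N h                    ∎

  sumL-∑<-comm : ∀ {a} {A : Set a} n (g : A → ℕ → Carrier) xs →
                 sumL R (map (λ x → ∑< n (g x)) xs) ≈ ∑< n (λ j → sumL R (map (λ x → g x j) xs))
  sumL-∑<-comm n g []       = sym (∑<-vanishing n (λ _ _ → refl))
  sumL-∑<-comm n g (x ∷ xs) = trans (+-congˡ (sumL-∑<-comm n g xs)) (sym (∑<-+ n (g x) _))

  ∑<-comm : ∀ m n (g : ℕ → ℕ → Carrier) → ∑< m (λ k → ∑< n (g k)) ≈ ∑< n (λ i → ∑< m (λ k → g k i))
  ∑<-comm m n g = begin
    ∑< m (λ k → ∑< n (g k))                     ≡⟨ ≡.sym (sumL-upTo m _) ⟩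
    sumL R (map (λ k → ∑< n (g k)) (upTo m))     ≈⟨ sumL-∑<-comm n g (upTo m) ⟩
    ∑< n (λ i → sumL R (map (λ k → g k i) (upTo m)))
      ≈⟨ ∑<-cong n (λ i _ → reflexive (sumL-upTo m (λ k → g k i))) ⟩
    ∑< n (λ i → ∑< m (λ k → g k i))              ∎

  ∑<-reverse : ∀ m (f : ℕ → Carrier) → ∑< (suc m) f ≈ ∑< (suc m) (λ k → f (m ∸ k))
  ∑<-reverse zero    f = ∑<-cong 1 λ { zero _ → refl ; (suc _) (s≤s ()) }
  ∑<-reverse (suc m) f = begin
    ∑< (suc (suc m)) f
      ≡⟨ ∑<-suc (suc m) f ⟩
    f 0 + ∑< (suc m) (f ∘ suc)
      ≈⟨ +-congˡ (∑<-reverse m (f ∘ suc)) ⟩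
    f 0 + ∑< (suc m) (λ k → f (suc (m ∸ k)))
      ≈⟨ +-comm _ _ ⟩
    ∑< (suc m) (λ k → f (suc (m ∸ k))) + f 0
      ≈⟨ +-congʳ (∑<-cong (suc m) λ k k≤m →
        reflexive (≡.cong f (≡.sym (ℕ.+-∸-assoc 1 (ℕ.≤-pred k≤m))))) ⟩
    ∑< (suc m) (λ k → f (suc m ∸ k)) + f 0
      ≡⟨ ≡.cong (λ i → ∑< (suc m) (λ k → f (suc m ∸ k)) + f i) (≡.sym (ℕ.n∸n≡0 (suc m))) ⟩
    ∑< (suc m) (λ k → f (suc m ∸ k)) + f (suc m ∸ suc m)
      ≈⟨ ∑<-last (suc m) (λ k → f (suc m ∸ k)) ⟨
    ∑< (suc (suc m)) (λ k → f (suc m ∸ k)) ∎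

  -- Formal power series

  infix  4 _≃_
  infixl 6 _⊕_
  infixl 7 _⊛_

  _≃_ : Series R → Series R → Set ℓ
  _≃_ = _≋_ R

  _⊛_ : Series R → Series R → Series R
  _⊛_ = _⋆_ R

  _⊕_ : Series R → Series R → Series R
  (F ⊕ G) m = F m + G m

  ⊛-coeff : ∀ F G m → (F ⊛ G) m ≡ ∑< (suc m) (λ k → F k * G (m ∸ k))
  ⊛-coeff F G m = sumL-upTo (suc m) (λ k → F k * G (m ∸ k))

  ⊛-zero : ∀ F G → (F ⊛ G) 0 ≈ F 0 * G 0
  ⊛-zero F G = +-identityʳ _

  ⊛-suc : ∀ F G m → (F ⊛ G) (suc m) ≈ F 0 * G (suc m) + ((F ∘ suc) ⊛ G) m
  ⊛-suc F G m = reflexive (≡.trans (⊛-coeff F G (suc m)) (≡.trans (∑<-suc (suc m) _)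
                  (≡.cong (F 0 * G (suc m) +_) (≡.sym (⊛-coeff (F ∘ suc) G m)))))

  ⊛-cong : ∀ {F F′ G G′} → F ≃ F′ → G ≃ G′ → F ⊛ G ≃ F′ ⊛ G′
  ⊛-cong {F} {F′} {G} {G′} F≃F′ G≃G′ m = begin
    (F ⊛ G) m                             ≡⟨ ⊛-coeff F G m ⟩
    ∑< (suc m) (λ k → F k * G (m ∸ k))     ≈⟨ ∑<-cong (suc m) (λ k _ → *-cong (F≃F′ k) (G≃G′ (m ∸ k))) ⟩
    ∑< (suc m) (λ k → F′ k * G′ (m ∸ k))   ≡⟨ ≡.sym (⊛-coeff F′ G′ m) ⟩
    (F′ ⊛ G′) m                           ∎

  ⊛-comm : ∀ F G → F ⊛ G ≃ G ⊛ F
  ⊛-comm F G m = begin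
    (F ⊛ G) m
      ≡⟨ ⊛-coeff F G m ⟩
    ∑< (suc m) (λ k → F k * G (m ∸ k))
      ≈⟨ ∑<-reverse m _ ⟩
    ∑< (suc m) (λ k → F (m ∸ k) * G (m ∸ (m ∸ k)))
      ≈⟨ ∑<-cong (suc m) (λ k k≤m →
        trans (*-comm _ _) (*-congʳ (reflexive (≡.cong G (ℕ.m∸[m∸n]≡n (ℕ.≤-pred k≤m)))))) ⟩
    ∑< (suc m) (λ k → G k * F (m ∸ k))
      ≡⟨ ≡.sym (⊛-coeff G F m) ⟩
    (G ⊛ F) m ∎

  ⊛-distribˡ : ∀ F G H → F ⊛ (G ⊕ H) ≃ F ⊛ G ⊕ F ⊛ H
  ⊛-distribˡ F G H m = begin
    (F ⊛ (G ⊕ H)) m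
      ≡⟨ ⊛-coeff F (G ⊕ H) m ⟩
    ∑< (suc m) (λ k → F k * (G (m ∸ k) + H (m ∸ k)))
      ≈⟨ ∑<-cong (suc m) (λ k _ → distribˡ (F k) _ _) ⟩
    ∑< (suc m) (λ k → F k * G (m ∸ k) + F k * H (m ∸ k))
      ≈⟨ ∑<-+ (suc m) _ _ ⟩
    ∑< (suc m) (λ k → F k * G (m ∸ k)) + ∑< (suc m) (λ k → F k * H (m ∸ k))
      ≡⟨ ≡.sym (≡.cong₂ _+_ (⊛-coeff F G m) (⊛-coeff F H m)) ⟩
    (F ⊛ G) m + (F ⊛ H) m ∎

  ⊛-linearˡ : ∀ a G H K m → ((λ k → a * G k + H k) ⊛ K) m ≈ a * (G ⊛ K) m + (H ⊛ K) m
  ⊛-linearˡ a G H K m = begin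
    ((λ k → a * G k + H k) ⊛ K) m
      ≡⟨ ⊛-coeff _ K m ⟩
    ∑< (suc m) (λ k → (a * G k + H k) * K (m ∸ k))
      ≈⟨ ∑<-cong (suc m) (λ k _ →
        trans (distribʳ _ _ _) (+-congʳ (*-assoc _ _ _))) ⟩
    ∑< (suc m) (λ k → a * (G k * K (m ∸ k)) + H k * K (m ∸ k))
      ≈⟨ ∑<-+ (suc m) _ _ ⟩
    ∑< (suc m) (λ k → a * (G k * K (m ∸ k))) + ∑< (suc m) (λ k → H k * K (m ∸ k))
      ≈⟨ +-congʳ (∑<-*ˡ (suc m) a _) ⟩
    a * ∑< (suc m) (λ k → G k * K (m ∸ k)) + ∑< (suc m) (λ k → H k * K (m ∸ k))
      ≡⟨ ≡.sym (≡.cong₂ (λ u v → a * u + v) (⊛-coeff G K m) (⊛-coeff H K m)) ⟩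
    a * (G ⊛ K) m + (H ⊛ K) m ∎

  ⊛-assoc : ∀ F G H → (F ⊛ G) ⊛ H ≃ F ⊛ (G ⊛ H)
  ⊛-assoc F G H zero = begin
    ((F ⊛ G) ⊛ H) 0     ≈⟨ ⊛-zero (F ⊛ G) H ⟩
    (F ⊛ G) 0 * H 0     ≈⟨ *-congʳ (⊛-zero F G) ⟩
    F 0 * G 0 * H 0     ≈⟨ *-assoc _ _ _ ⟩
    F 0 * (G 0 * H 0)   ≈⟨ *-congˡ (⊛-zero G H) ⟨
    F 0 * (G ⊛ H) 0     ≈⟨ ⊛-zero F (G ⊛ H) ⟨
    (F ⊛ (G ⊛ H)) 0     ∎
  ⊛-assoc F G H (suc m) = begin
    ((F ⊛ G) ⊛ H) (suc m)
      ≈⟨ ⊛-suc (F ⊛ G) H m ⟩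
    (F ⊛ G) 0 * H (suc m) + (((F ⊛ G) ∘ suc) ⊛ H) m
      ≈⟨ +-cong (*-congʳ (⊛-zero F G)) (⊛-cong {G = H} (⊛-suc F G) (λ _ → refl) m) ⟩
    F 0 * G 0 * H (suc m) + ((λ k → F 0 * G (suc k) + ((F ∘ suc) ⊛ G) k) ⊛ H) m
      ≈⟨ +-congˡ (⊛-linearˡ (F 0) (G ∘ suc) ((F ∘ suc) ⊛ G) H m) ⟩
    F 0 * G 0 * H (suc m) + (F 0 * ((G ∘ suc) ⊛ H) m + (((F ∘ suc) ⊛ G) ⊛ H) m)
      ≈⟨ +-congˡ (+-congˡ (⊛-assoc (F ∘ suc) G H m)) ⟩
    F 0 * G 0 * H (suc m) + (F 0 * ((G ∘ suc) ⊛ H) m + ((F ∘ suc) ⊛ (G ⊛ H)) m)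
      ≈⟨ solve 5 (λ f g h s t → f :* g :* h :+ (f :* s :+ t) := f :* (g :* h :+ s) :+ t) refl _ _ _ _ _ ⟩
    F 0 * (G 0 * H (suc m) + ((G ∘ suc) ⊛ H) m) + ((F ∘ suc) ⊛ (G ⊛ H)) m
      ≈⟨ +-congʳ (*-congˡ (⊛-suc G H m)) ⟨
    F 0 * (G ⊛ H) (suc m) + ((F ∘ suc) ⊛ (G ⊛ H)) m
      ≈⟨ ⊛-suc F (G ⊛ H) m ⟨
    (F ⊛ (G ⊛ H)) (suc m)
      ∎

  ⊛-identityʳ : ∀ F → F ⊛ oneS R ≃ F
  ⊛-identityʳ F zero    = trans (⊛-zero F (oneS R)) (*-identityʳ (F 0))
  ⊛-identityʳ F (suc m) = begin
    (F ⊛ oneS R) (suc m)              ≈⟨ ⊛-suc F (oneS R) m ⟩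
    F 0 * 0# + ((F ∘ suc) ⊛ oneS R) m ≈⟨ +-cong (zeroʳ (F 0)) (⊛-identityʳ (F ∘ suc) m) ⟩
    0# + F (suc m)                    ≈⟨ +-identityˡ _ ⟩
    F (suc m)                         ∎

  ⊛-suc-vanishing : ∀ F G m → F 0 ≈ 0# → G 0 ≈ 0# → (F ⊛ G) (suc m) ≈ ∑< m (λ i → F (suc i) * G (m ∸ i))
  ⊛-suc-vanishing F G m F₀≈0 G₀≈0 = begin
    (F ⊛ G) (suc m)
      ≈⟨ ⊛-suc F G m ⟩
    F 0 * G (suc m) + ((F ∘ suc) ⊛ G) m
      ≈⟨ +-cong (trans (*-congʳ F₀≈0) (zeroˡ _)) (reflexive (⊛-coeff (F ∘ suc) G m)) ⟩
    0# + ∑< (suc m) (λ i → F (suc i) * G (m ∸ i))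
      ≈⟨ +-identityˡ _ ⟩
    ∑< (suc m) (λ i → F (suc i) * G (m ∸ i))
      ≈⟨ ∑<-last m _ ⟩
    ∑< m (λ i → F (suc i) * G (m ∸ i)) + F (suc m) * G (m ∸ m)
      ≈⟨ +-congˡ (trans (*-congˡ (trans (reflexive (≡.cong G (ℕ.n∸n≡0 m))) G₀≈0)) (zeroʳ _)) ⟩
    ∑< m (λ i → F (suc i) * G (m ∸ i)) + 0#
      ≈⟨ +-identityʳ _ ⟩
    ∑< m (λ i → F (suc i) * G (m ∸ i)) ∎

  ⊛-congʳ-below : ∀ F {G G′} m → (∀ j → j ≤ m → G j ≈ G′ j) → (F ⊛ G) m ≈ (F ⊛ G′) m
  ⊛-congʳ-below F {G} {G′} m G≈G′ = begin
    (F ⊛ G) m                             ≡⟨ ⊛-coeff F G m ⟩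
    ∑< (suc m) (λ k → F k * G (m ∸ k))     ≈⟨ ∑<-cong (suc m) (λ k _ → *-congˡ (G≈G′ (m ∸ k) (ℕ.m∸n≤m m k))) ⟩
    ∑< (suc m) (λ k → F k * G′ (m ∸ k))    ≡⟨ ≡.sym (⊛-coeff F G′ m) ⟩
    (F ⊛ G′) m                            ∎

  -- The linear equation X = C + D X

  module _ (D : Series R) (D₀≈0 : D 0 ≈ 0#) where

    D₀*-irrelevant : ∀ a b → D 0 * a ≈ D 0 * b
    D₀*-irrelevant a b = trans (*-congʳ D₀≈0) (trans (zeroˡ a) (sym (trans (*-congʳ D₀≈0) (zeroˡ b))))

    ⊛-determined-below : ∀ {X Y} m → (∀ {j} → j < m → X j ≈ Y j) → (D ⊛ X) m ≈ (D ⊛ Y) m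
    ⊛-determined-below {X} {Y} zero    _     =
      trans (⊛-zero D X) (trans (D₀*-irrelevant _ _) (sym (⊛-zero D Y)))
    ⊛-determined-below {X} {Y} (suc m) X≈Y = begin
      (D ⊛ X) (suc m)
        ≈⟨ ⊛-suc D X m ⟩
      D 0 * X (suc m) + ((D ∘ suc) ⊛ X) m
        ≈⟨ +-cong (D₀*-irrelevant _ _) (⊛-congʳ-below (D ∘ suc) m (λ j j≤m → X≈Y (s≤s j≤m))) ⟩
      D 0 * Y (suc m) + ((D ∘ suc) ⊛ Y) m
        ≈⟨ ⊛-suc D Y m ⟨
      (D ⊛ Y) (suc m) ∎

    linear-unique : ∀ {C X Y} → X ≃ C ⊕ D ⊛ X → Y ≃ C ⊕ D ⊛ Y → X ≃ Y
    linear-unique {C} {X} {Y} X≃ Y≃ = <-rec (λ m → X m ≈ Y m) λ m X≈Y<m →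
      trans (X≃ m) (trans (+-congˡ (⊛-determined-below m X≈Y<m)) (sym (Y≃ m)))

    powS-vanishes : ∀ k m → m < k → powS R D k m ≈ 0#
    powS-vanishes (suc k) zero    _         = trans (⊛-zero D (powS R D k)) (trans (*-congʳ D₀≈0) (zeroˡ _))
    powS-vanishes (suc k) (suc m) (s≤s m<k) = begin
      (D ⊛ powS R D k) (suc m)
        ≈⟨ ⊛-suc D (powS R D k) m ⟩
      D 0 * powS R D k (suc m) + ((D ∘ suc) ⊛ powS R D k) m
        ≈⟨ +-cong (trans (*-congʳ D₀≈0) (zeroˡ _)) (reflexive (⊛-coeff (D ∘ suc) (powS R D k) m)) ⟩
      0# + ∑< (suc m) (λ i → D (suc i) * powS R D k (m ∸ i))
        ≈⟨ +-identityˡ _ ⟩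
      ∑< (suc m) (λ i → D (suc i) * powS R D k (m ∸ i))
        ≈⟨ ∑<-vanishing (suc m) (λ i _ →
          trans (*-congˡ (powS-vanishes k (m ∸ i) (ℕ.≤-<-trans (ℕ.m∸n≤m m i) m<k)))
          (zeroʳ _)) ⟩
      0# ∎

    invOneMinus-truncated : ∀ N m → m < N → ∑< N (λ k → powS R D k m) ≈ invOneMinus R D m
    invOneMinus-truncated N m m<N = begin
      ∑< N (λ k → powS R D k m)
        ≡⟨ ≡.cong (λ n → ∑< n (λ k → powS R D k m)) (≡.sym (ℕ.m+[n∸m]≡n m<N)) ⟩
      ∑< (suc m +ℕ (N ∸ suc m)) (λ k → powS R D k m)
        ≈⟨ ∑<-vanishing-tail (suc m) (N ∸ suc m) (λ k m<k → powS-vanishes k m m<k) ⟩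
      ∑< (suc m) (λ k → powS R D k m)
        ≡⟨ ≡.sym (sumL-upTo (suc m) (λ k → powS R D k m)) ⟩
      invOneMinus R D m ∎

    invOneMinus-fixpoint : invOneMinus R D ≃ oneS R ⊕ D ⊛ invOneMinus R D
    invOneMinus-fixpoint m = begin
      invOneMinus R D m
        ≈⟨ invOneMinus-truncated (suc m) m ℕ.≤-refl ⟨
      ∑< (suc m) (λ k → powS R D k m)
        ≡⟨ ∑<-suc m _ ⟩
      oneS R m + ∑< m (λ k → (D ⊛ powS R D k) m)
        ≈⟨ +-congˡ (∑<-cong m (λ k _ → reflexive (⊛-coeff D (powS R D k) m))) ⟩
      oneS R m + ∑< m (λ k → ∑< (suc m) (λ i → D i * powS R D k (m ∸ i)))
        ≈⟨ +-congˡ (∑<-comm m (suc m) _) ⟩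
      oneS R m + ∑< (suc m) (λ i → ∑< m (λ k → D i * powS R D k (m ∸ i)))
        ≈⟨ +-congˡ (∑<-cong (suc m) inner) ⟩
      oneS R m + ∑< (suc m) (λ i → D i * invOneMinus R D (m ∸ i))
        ≡⟨ ≡.cong (oneS R m +_) (≡.sym (⊛-coeff D (invOneMinus R D) m)) ⟩
      oneS R m + (D ⊛ invOneMinus R D) m ∎
      where
      inner : ∀ i → i < suc m → ∑< m (λ k → D i * powS R D k (m ∸ i)) ≈ D i * invOneMinus R D (m ∸ i)
      inner zero    _         = trans (∑<-*ˡ m (D 0) _) (D₀*-irrelevant _ _)
      inner (suc i) (s≤s i<m) = trans (∑<-*ˡ m (D (suc i)) _)
        (*-congˡ (invOneMinus-truncated m (m ∸ suc i) (ℕ.∸-monoʳ-< {m} (s≤s z≤n) i<m)))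

    linear-solution : ∀ {C X} → X ≃ C ⊕ D ⊛ X → X ≃ C ⊛ invOneMinus R D
    linear-solution {C} X≃ = linear-unique X≃ CG≃
      where
      G : Series R
      G = invOneMinus R D
      CG≃ : C ⊛ G ≃ C ⊕ D ⊛ (C ⊛ G)
      CG≃ m = begin
        (C ⊛ G) m                          ≈⟨ ⊛-cong {C} (λ _ → refl) invOneMinus-fixpoint m ⟩
        (C ⊛ (oneS R ⊕ D ⊛ G)) m           ≈⟨ ⊛-distribˡ C (oneS R) (D ⊛ G) m ⟩
        (C ⊛ oneS R) m + (C ⊛ (D ⊛ G)) m   ≈⟨ +-cong (⊛-identityʳ C m) (sym (⊛-assoc C D G m)) ⟩
        C m + ((C ⊛ D) ⊛ G) m              ≈⟨ +-congˡ (⊛-cong {G = G} (⊛-comm C D) (λ _ → refl) m) ⟩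
        C m + ((D ⊛ C) ⊛ G) m              ≈⟨ +-congˡ (⊛-assoc D C G m) ⟩
        C m + (D ⊛ (C ⊛ G)) m              ∎

  ⟦_⟧ : Bool → Carrier
  ⟦ true  ⟧ = 1#
  ⟦ false ⟧ = 0#

  -- S ⊆ [n-1] cuts [n] into blocks of consecutive integers, one ending at each element of S;
  -- blockProduct f k S is ∏ f |B| over the blocks, with k further elements prepended to the first.
  blockProduct : (ℕ → Carrier) → ℕ → List Bool → Carrier
  blockProduct f k []          = f (suc k)
  blockProduct f k (true ∷ S)  = f (suc k) * blockProduct f 0 S
  blockProduct f k (false ∷ S) = blockProduct f (suc k) S

  blockProduct-inverse : ∀ {f g} → (∀ n → f n * g n ≈ 1#) →
                         ∀ k S → blockProduct f k S * blockProduct g k S ≈ 1#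
  blockProduct-inverse fg≈1 k []          = fg≈1 (suc k)
  blockProduct-inverse {f} {g} fg≈1 k (true ∷ S) = begin
    (f (suc k) * blockProduct f 0 S) * (g (suc k) * blockProduct g 0 S)
      ≈⟨ solve 4 (λ a b c d → (a :* b) :* (c :* d) := (a :* c) :* (b :* d)) refl _ _ _ _ ⟩
    (f (suc k) * g (suc k)) * (blockProduct f 0 S * blockProduct g 0 S)
      ≈⟨ *-cong (fg≈1 (suc k)) (blockProduct-inverse fg≈1 0 S) ⟩
    1# * 1#
      ≈⟨ *-identityˡ 1# ⟩
    1# ∎
  blockProduct-inverse fg≈1 k (false ∷ S) = blockProduct-inverse fg≈1 (suc k) S

  module _ (q : Carrier) where

    pow-+ : ∀ m n → pow R q (m +ℕ n) ≈ pow R q m * pow R q n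
    pow-+ zero    n = sym (*-identityˡ _)
    pow-+ (suc m) n = trans (*-congˡ (pow-+ m n)) (sym (*-assoc _ _ _))

    qint-suc : ∀ n → qint R q (suc n) ≈ qint R q n + pow R q n
    qint-suc n = begin
      qint R q (suc n)          ≡⟨ sumL-upTo (suc n) (pow R q) ⟩
      ∑< (suc n) (pow R q)      ≈⟨ ∑<-last n (pow R q) ⟩
      ∑< n (pow R q) + pow R q n ≡⟨ ≡.cong (_+ pow R q n) (≡.sym (sumL-upTo n (pow R q))) ⟩
      qint R q n + pow R q n    ∎

    qint-+ : ∀ m n → qint R q (m +ℕ n) ≈ qint R q m + pow R q m * qint R q n
    qint-+ m zero    = trans (reflexive (≡.cong (qint R q) (ℕ.+-identityʳ m)))
                             (sym (trans (+-congˡ (zeroʳ (pow R q m))) (+-identityʳ _)))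
    qint-+ m (suc n) = begin
      qint R q (m +ℕ suc n)
        ≡⟨ ≡.cong (qint R q) (ℕ.+-suc m n) ⟩
      qint R q (suc (m +ℕ n))
        ≈⟨ qint-suc (m +ℕ n) ⟩
      qint R q (m +ℕ n) + pow R q (m +ℕ n)
        ≈⟨ +-cong (qint-+ m n) (pow-+ m n) ⟩
      (qint R q m + pow R q m * qint R q n) + pow R q m * pow R q n
        ≈⟨ solve 4 (λ a b c d → (a :+ b :* c) :+ b :* d := a :+ b :* (c :+ d)) refl _ _ _ _ ⟩
      qint R q m + pow R q m * (qint R q n + pow R q n)
        ≈⟨ +-congˡ (*-congˡ (qint-suc n)) ⟨
      qint R q m + pow R q m * qint R q (suc n) ∎

    descentWeight : List Bool → List ℕ → Carrier
    descentWeight S σ = if descSet σ ⊆ᵇ S then pow R q (invCount σ) else 0#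

    if-∧-pow : ∀ u v m n → (if u ∧ v then pow R q (m +ℕ n) else 0#) ≈
                           ⟦ u ⟧ * (pow R q m * (if v then pow R q n else 0#))
    if-∧-pow true  true  m n = trans (pow-+ m n) (sym (*-identityˡ _))
    if-∧-pow true  false m n = sym (trans (*-identityˡ _) (zeroʳ _))
    if-∧-pow false v     m n = sym (zeroˡ _)

    descentWeight-insertAt : ∀ j a σ S → All (_< a) σ → length σ ≡ length S → j ≤ length σ →
      descentWeight S (insertAt j a σ) ≈ ⟦ isBlockEnd j S ⟧ * (pow R q (length σ ∸ j) * descentWeight (contract j S) σ)
    descentWeight-insertAt j a σ S σ<a len j≤n = begin
      descentWeight S (insertAt j a σ)
        ≡⟨ ≡.cong₂ (λ b n → if b then pow R q n else 0#)
                   (descSet-insertAt j a σ S σ<a len j≤n) (invCount-insertAt j a σ σ<a j≤n) ⟩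
      (if isBlockEnd j S ∧ (descSet σ ⊆ᵇ contract j S) then pow R q ((length σ ∸ j) +ℕ invCount σ) else 0#)
        ≈⟨ if-∧-pow (isBlockEnd j S) _ (length σ ∸ j) (invCount σ) ⟩
      ⟦ isBlockEnd j S ⟧ * (pow R q (length σ ∸ j) * descentWeight (contract j S) σ) ∎

    alpha-insertMax : ∀ n S → length S ≡ n →
      alpha R (suc n) S q ≈ ∑< (suc n) (λ j → ⟦ isBlockEnd j S ⟧ * (pow R q (n ∸ j) * alpha R n (contract j S) q))
    alpha-insertMax n S len = begin
      sumL R (map (descentWeight S) (concatMap (insertAll n) (perms n)))
        ≈⟨ sumL-concatMap (descentWeight S) (insertAll n) (perms n) ⟩
      sumL R (map (λ σ → sumL R (map (descentWeight S) (insertAll n σ))) (perms n))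
        ≈⟨ sumL-congᴬ _ (λ σ → ∑< (suc n) (term σ)) (perms-words n) insertMax ⟩
      sumL R (map (λ σ → ∑< (suc n) (term σ)) (perms n))
        ≈⟨ sumL-∑<-comm (suc n) term (perms n) ⟩
      ∑< (suc n) (λ j → sumL R (map (λ σ → term σ j) (perms n)))
        ≈⟨ ∑<-cong (suc n) (λ j _ → trans (sumL-*ˡ _ _ (perms n)) (*-congˡ (sumL-*ˡ _ _ (perms n)))) ⟩
      ∑< (suc n) (λ j → ⟦ isBlockEnd j S ⟧ * (pow R q (n ∸ j) * alpha R n (contract j S) q)) ∎
      where
      term : List ℕ → ℕ → Carrier
      term σ j = ⟦ isBlockEnd j S ⟧ * (pow R q (n ∸ j) * descentWeight (contract j S) σ)

      insertMax : ∀ {σ} → Word n σ → sumL R (map (descentWeight S) (insertAll n σ)) ≈ ∑< (suc n) (term σ)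
      insertMax {σ} (lenσ , σ<n) = begin
        sumL R (map (descentWeight S) (insertAll n σ))
          ≡⟨ ≡.cong (λ τs → sumL R (map (descentWeight S) τs)) (insertAll-insertAt n σ) ⟩
        sumL R (map (descentWeight S) (applyUpTo (λ j → insertAt j n σ) (suc (length σ))))
          ≡⟨ sumL-applyUpTo (suc (length σ)) (descentWeight S) (λ j → insertAt j n σ) ⟩
        ∑< (suc (length σ)) (λ j → descentWeight S (insertAt j n σ))
          ≡⟨ ≡.cong (λ l → ∑< (suc l) (λ j → descentWeight S (insertAt j n σ))) lenσ ⟩
        ∑< (suc n) (λ j → descentWeight S (insertAt j n σ))
          ≈⟨ ∑<-cong (suc n) (λ j j≤n → trans
               (descentWeight-insertAt j n σ S σ<n (≡.trans lenσ (≡.sym len)) (≡.subst (j ≤_) (≡.sym lenσ) (ℕ.≤-pred j≤n)))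
               (reflexive (≡.cong (λ l → ⟦ isBlockEnd j S ⟧ * (pow R q (l ∸ j) * descentWeight (contract j S) σ))
                                  lenσ))) ⟩
        ∑< (suc n) (term σ) ∎

    blockFactorials-contract-suc : ∀ k j S → isBlockEnd (suc j) S ≡ true →
      blockProduct (qfact R q) k S ≈ blockProduct (qfact R q) k (contract (suc j) S) * qint R q (blockLength k (suc j) S)
    blockFactorials-contract-suc k zero    (true  ∷ [])         _ = *-congˡ (*-identityˡ _)
    blockFactorials-contract-suc k zero    (false ∷ [])         _ = refl
    blockFactorials-contract-suc k zero    (true  ∷ true ∷ S)   _ =
      solve 3 (λ a b c → a :* ((con 1 :* c) :* b) := (a :* b) :* c) refl
        (qfact R q (suc k)) (blockProduct (qfact R q) 0 S) (qint R q 1)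
    blockFactorials-contract-suc k zero    (false ∷ true ∷ S)   _ =
      solve 3 (λ a b c → (a :* c) :* b := (a :* b) :* c) refl
        (qfact R q (suc k)) (blockProduct (qfact R q) 0 S) (qint R q (suc (suc k)))
    blockFactorials-contract-suc k (suc j) (true  ∷ S) be =
      trans (*-congˡ (blockFactorials-contract-suc 0 j S be)) (sym (*-assoc _ _ _))
    blockFactorials-contract-suc k (suc j) (false ∷ S) be = blockFactorials-contract-suc (suc k) j S be

    blockFactorials-contract : ∀ j s S → isBlockEnd j (s ∷ S) ≡ true →
      blockProduct (qfact R q) 0 (s ∷ S) ≈
      blockProduct (qfact R q) 0 (contract j (s ∷ S)) * qint R q (blockLength 0 j (s ∷ S))
    blockFactorials-contract zero    true S _  = trans (*-comm _ _) (*-congˡ (*-identityˡ _))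
    blockFactorials-contract (suc j) s    S be = blockFactorials-contract-suc 0 j (s ∷ S) be

    qint-blockLengths : ∀ k S n → length S ≡ n →
      ∑< (suc n) (λ j → ⟦ isBlockEnd j S ⟧ * (pow R q (n ∸ j) * qint R q (blockLength k j S))) ≈ qint R q (suc k +ℕ n)
    qint-blockLengths k []      zero    _ = begin
      ∑< 1 (λ j → ⟦ isBlockEnd j [] ⟧ * (pow R q (0 ∸ j) * qint R q (blockLength k j [])))
        ≡⟨ ≡.trans (∑<-suc 0 _) (≡.cong (1# * (1# * qint R q (suc k)) +_) (∑<-empty _)) ⟩
      1# * (1# * qint R q (suc k)) + 0# ≈⟨ trans (+-identityʳ _) (trans (*-identityˡ _) (*-identityˡ _)) ⟩
      qint R q (suc k)                 ≡⟨ ≡.cong (qint R q) (≡.sym (ℕ.+-identityʳ (suc k))) ⟩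
      qint R q (suc k +ℕ 0)            ∎
    qint-blockLengths k (true ∷ S) (suc n) len = begin
      ∑< (suc (suc n)) (λ j → ⟦ isBlockEnd j (true ∷ S) ⟧ * (pow R q (suc n ∸ j) * qint R q (blockLength k j (true ∷ S))))
        ≡⟨ ∑<-suc (suc n) _ ⟩
      1# * (pow R q (suc n) * qint R q (suc k)) + ∑< (suc n) (λ j → ⟦ isBlockEnd j S ⟧ * (pow R q (n ∸ j) * qint R q (blockLength 0 j S)))
        ≈⟨ +-cong (*-identityˡ _) (qint-blockLengths 0 S n (ℕ.suc-injective len)) ⟩
      pow R q (suc n) * qint R q (suc k) + qint R q (suc n)
        ≈⟨ +-comm _ _ ⟩
      qint R q (suc n) + pow R q (suc n) * qint R q (suc k)
        ≈⟨ qint-+ (suc n) (suc k) ⟨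
      qint R q (suc n +ℕ suc k)
        ≡⟨ ≡.cong (qint R q) (ℕ.+-comm (suc n) (suc k)) ⟩
      qint R q (suc k +ℕ suc n) ∎
    qint-blockLengths k (false ∷ S) (suc n) len = begin
      ∑< (suc (suc n)) (λ j → ⟦ isBlockEnd j (false ∷ S) ⟧ * (pow R q (suc n ∸ j) * qint R q (blockLength k j (false ∷ S))))
        ≡⟨ ∑<-suc (suc n) _ ⟩
      0# * (pow R q (suc n) * qint R q (suc k)) + ∑< (suc n) (λ j → ⟦ isBlockEnd j S ⟧ * (pow R q (n ∸ j) * qint R q (blockLength (suc k) j S)))
        ≈⟨ +-cong (zeroˡ _) (qint-blockLengths (suc k) S n (ℕ.suc-injective len)) ⟩
      0# + qint R q (suc (suc k) +ℕ n)
        ≈⟨ +-identityˡ _ ⟩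
      qint R q (suc (suc k) +ℕ n)
        ≡⟨ ≡.cong (qint R q) (≡.sym (ℕ.+-suc (suc k) n)) ⟩
      qint R q (suc k +ℕ suc n) ∎

    alpha-blockFactorials : ∀ n S → length S ≡ n →
                            alpha R (suc n) S q * blockProduct (qfact R q) 0 S ≈ qfact R q (suc n)
    alpha-blockFactorials zero    []      _   = trans (*-congʳ (+-identityʳ 1#)) (*-identityˡ _)
    alpha-blockFactorials (suc m) (s ∷ T) len = begin
      alpha R (suc n) S q * W
        ≈⟨ *-congʳ (alpha-insertMax n S len) ⟩
      ∑< (suc n) (λ j → ⟦ isBlockEnd j S ⟧ * (pow R q (n ∸ j) * alpha R n (contract j S) q)) * W
        ≈⟨ ∑<-*ʳ (suc n) W _ ⟨
      ∑< (suc n) (λ j → ⟦ isBlockEnd j S ⟧ * (pow R q (n ∸ j) * alpha R n (contract j S) q) * W)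
        ≈⟨ ∑<-cong (suc n) (λ j j≤n → removeMax j (ℕ.≤-pred j≤n)) ⟩
      ∑< (suc n) (λ j → ⟦ isBlockEnd j S ⟧ * (pow R q (n ∸ j) * qint R q (blockLength 0 j S)) * qfact R q n)
        ≈⟨ ∑<-*ʳ (suc n) (qfact R q n) _ ⟩
      ∑< (suc n) (λ j → ⟦ isBlockEnd j S ⟧ * (pow R q (n ∸ j) * qint R q (blockLength 0 j S))) * qfact R q n
        ≈⟨ *-congʳ (qint-blockLengths 0 S n len) ⟩
      qint R q (suc n) * qfact R q n
        ≈⟨ *-comm _ _ ⟩
      qfact R q (suc n) ∎
      where
      n : ℕ
      n = suc m
      S : List Bool
      S = s ∷ T
      W : Carrier
      W = blockProduct (qfact R q) 0 S

      removeMax : ∀ j → j ≤ n →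
        ⟦ isBlockEnd j S ⟧ * (pow R q (n ∸ j) * alpha R n (contract j S) q) * W ≈
        ⟦ isBlockEnd j S ⟧ * (pow R q (n ∸ j) * qint R q (blockLength 0 j S)) * qfact R q n
      removeMax j j≤n with isBlockEnd j S in be
      ... | false = trans (*-congʳ (zeroˡ _)) (trans (zeroˡ _) (sym (trans (*-congʳ (zeroˡ _)) (zeroˡ _))))
      ... | true  = begin
        1# * (P * A) * W
          ≈⟨ *-congˡ (blockFactorials-contract j s T be) ⟩
        1# * (P * A) * (W′ * L)
          ≈⟨ solve 4 (λ p a w l → con 1 :* (p :* a) :* (w :* l) := con 1 :* (p :* l) :* (a :* w)) refl P A W′ L ⟩
        1# * (P * L) * (A * W′)
          ≈⟨ *-congˡ (alpha-blockFactorials m (contract j S) length-contract′) ⟩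
        1# * (P * L) * qfact R q n ∎
        where
        P A W′ L : Carrier
        P = pow R q (n ∸ j)
        A = alpha R n (contract j S) q
        W′ = blockProduct (qfact R q) 0 (contract j S)
        L = qint R q (blockLength 0 j S)
        length-contract′ : length (contract j S) ≡ m
        length-contract′ = ≡.trans (length-contract j S (≡.subst (j ≤_) (≡.sym len) j≤n)) (≡.cong pred len)

  -- Weighted subsets and the first even element

  module _ (x q : Carrier) (ι : ℕ → Carrier) (ι-inverse : ∀ n → qfact R q n * ι n ≈ 1#) where

    alpha-inverseBlockFactorials : ∀ n S → length S ≡ n → alpha R (suc n) S q * ι (suc n) ≈ blockProduct ι 0 S
    alpha-inverseBlockFactorials n S len = begin
      A * I                     ≈⟨ *-identityʳ _ ⟨
      A * I * 1#                ≈⟨ *-congˡ (blockProduct-inverse ι-inverse 0 S) ⟨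
      A * I * (F * W)           ≈⟨ solve 4 (λ a i f w → a :* i :* (f :* w) := a :* f :* i :* w) refl A I F W ⟩
      A * F * I * W             ≈⟨ *-congʳ (*-congʳ (alpha-blockFactorials q n S len)) ⟩
      qfact R q (suc n) * I * W ≈⟨ *-congʳ (ι-inverse (suc n)) ⟩
      1# * W                    ≈⟨ *-identityˡ W ⟩
      W                         ∎
      where
      A I F W : Carrier
      A = alpha R (suc n) S q
      I = ι (suc n)
      F = blockProduct (qfact R q) 0 S
      W = blockProduct ι 0 S

    count : Bool → List Bool → ℕ
    count true  = oddCount
    count false = evenCount

    entryVariable : Bool → Carrier → Carrier
    entryVariable true  y = x
    entryVariable false y = y

    -- The flag o tells whether the first entry of S is an odd element of [n-1].
    weight : Carrier → Bool → ℕ → List Bool → Carrier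
    weight y o k S = blockProduct ι k S * pow R x (count o S) * pow R y (count (not o) S)

    weightSum : Carrier → Bool → ℕ → ℕ → Carrier
    weightSum y o k n = sumL R (map (weight y o k) (subsets n))

    weight-true : ∀ y o k S → weight y o k (true ∷ S) ≈ ι (suc k) * entryVariable o y * weight y (not o) 0 S
    weight-true y true  k S = solve 5 (λ i w v e u → i :* w :* (v :* e) :* u := i :* v :* (w :* e :* u)) refl
                                (ι (suc k)) (blockProduct ι 0 S) x (pow R x (evenCount S)) (pow R y (oddCount S))
    weight-true y false k S = solve 5 (λ i w e v u → i :* w :* e :* (v :* u) := i :* v :* (w :* e :* u)) refl
                                (ι (suc k)) (blockProduct ι 0 S) (pow R x (oddCount S)) y (pow R y (evenCount S))

    weight-false : ∀ y o k S → weight y o k (false ∷ S) ≈ weight y (not o) (suc k) S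
    weight-false y true  k S = refl
    weight-false y false k S = refl

    weightSum-zero : ∀ y o k → weightSum y o k 0 ≈ ι (suc k)
    weightSum-zero y true  k = trans (+-identityʳ _) (trans (*-identityʳ _) (*-identityʳ _))
    weightSum-zero y false k = trans (+-identityʳ _) (trans (*-identityʳ _) (*-identityʳ _))

    weightSum-suc : ∀ y o k n →
      weightSum y o k (suc n) ≈ ι (suc k) * entryVariable o y * weightSum y (not o) 0 n + weightSum y (not o) (suc k) n
    weightSum-suc y o k n = begin
      sumL R (map (weight y o k) (map (true ∷_) Ss ++ map (false ∷_) Ss))
        ≡⟨ ≡.cong (sumL R) (List.map-++ (weight y o k) (map (true ∷_) Ss) _) ⟩
      sumL R (map (weight y o k) (map (true ∷_) Ss) ++ map (weight y o k) (map (false ∷_) Ss))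
        ≈⟨ sumL-++ (map (weight y o k) (map (true ∷_) Ss)) _ ⟩
      sumL R (map (weight y o k) (map (true ∷_) Ss)) + sumL R (map (weight y o k) (map (false ∷_) Ss))
        ≡⟨ ≡.sym (≡.cong₂ (λ u v → sumL R u + sumL R v) (List.map-∘ Ss) (List.map-∘ Ss)) ⟩
      sumL R (map (weight y o k ∘ (true ∷_)) Ss) + sumL R (map (weight y o k ∘ (false ∷_)) Ss)
        ≈⟨ +-cong (sumL-cong _ _ Ss (weight-true y o k)) (sumL-cong _ _ Ss (weight-false y o k)) ⟩
      sumL R (map (λ S → ι (suc k) * entryVariable o y * weight y (not o) 0 S) Ss) + weightSum y (not o) (suc k) n
        ≈⟨ +-congʳ (sumL-*ˡ _ (weight y (not o) 0) Ss) ⟩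
      ι (suc k) * entryVariable o y * weightSum y (not o) 0 n + weightSum y (not o) (suc k) n ∎
      where
      Ss : List (List Bool)
      Ss = subsets n

    Ppoly-weightSum : ∀ y n → Ppoly R (suc n) x y q * ι (suc n) ≈ weightSum y true 0 n
    Ppoly-weightSum y n = begin
      sumL R (map term (subsets n)) * ι (suc n)
        ≈⟨ sumL-*ʳ (ι (suc n)) term (subsets n) ⟨
      sumL R (map (λ S → term S * ι (suc n)) (subsets n))
        ≈⟨ sumL-congᴬ _ (weight y true 0) (subsets-length n) termwise ⟩
      weightSum y true 0 n ∎
      where
      term : List Bool → Carrier
      term S = alpha R (suc n) S q * pow R x (oddCount S) * pow R y (evenCount S)

      termwise : ∀ {S} → length S ≡ n → term S * ι (suc n) ≈ weight y true 0 S
      termwise {S} len = trans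
        (solve 4 (λ a u v i → a :* u :* v :* i := a :* i :* u :* v) refl
           (alpha R (suc n) S q) (pow R x (oddCount S)) (pow R y (evenCount S)) (ι (suc n)))
        (*-congʳ (*-congʳ (alpha-inverseBlockFactorials n S len)))

    -- Entry i of S is even exactly when hasParity o (suc i).
    firstEvenSum : Carrier → Bool → ℕ → ℕ → Carrier
    firstEvenSum y o k n = ∑< n (λ i → ⟦ hasParity o (suc i) ⟧ * weightSum 0# o k i * weightSum y true 0 (n ∸ suc i))

    firstEvenSum-suc : ∀ y o k n → firstEvenSum y o k (suc n) ≈
      ⟦ not o ⟧ * ι (suc k) * weightSum y true 0 n
      + (ι (suc k) * entryVariable o 0# * firstEvenSum y (not o) 0 n + firstEvenSum y (not o) (suc k) n)
    firstEvenSum-suc y o k n = begin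
      firstEvenSum y o k (suc n)
        ≡⟨ ∑<-suc n _ ⟩
      ⟦ hasParity o 1 ⟧ * weightSum 0# o k 0 * Wy n
      + ∑< n (λ i → ⟦ hasParity o (suc (suc i)) ⟧ * weightSum 0# o k (suc i) * Wy (n ∸ suc i))
        ≈⟨ +-cong (*-congʳ (*-cong (reflexive (≡.cong ⟦_⟧ (hasParity-one o))) (weightSum-zero 0# o k)))
                  (∑<-cong n (λ i _ → split i)) ⟩
      ⟦ not o ⟧ * ι (suc k) * Wy n + ∑< n (λ i → κ * E₀ i + E₁ i)
        ≈⟨ +-congˡ (∑<-+ n _ _) ⟩
      ⟦ not o ⟧ * ι (suc k) * Wy n + (∑< n (λ i → κ * E₀ i) + firstEvenSum y (not o) (suc k) n)
        ≈⟨ +-congˡ (+-congʳ (∑<-*ˡ n κ E₀)) ⟩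
      ⟦ not o ⟧ * ι (suc k) * Wy n + (κ * firstEvenSum y (not o) 0 n + firstEvenSum y (not o) (suc k) n) ∎
      where
      Wy : ℕ → Carrier
      Wy = weightSum y true 0
      κ : Carrier
      κ = ι (suc k) * entryVariable o 0#
      E₀ E₁ : ℕ → Carrier
      E₀ i = ⟦ hasParity (not o) (suc i) ⟧ * weightSum 0# (not o) 0 i * Wy (n ∸ suc i)
      E₁ i = ⟦ hasParity (not o) (suc i) ⟧ * weightSum 0# (not o) (suc k) i * Wy (n ∸ suc i)

      hasParity-one : ∀ o → hasParity o 1 ≡ not o
      hasParity-one true  = ≡.refl
      hasParity-one false = ≡.refl

      split : ∀ i → ⟦ hasParity o (suc (suc i)) ⟧ * weightSum 0# o k (suc i) * Wy (n ∸ suc i) ≈ κ * E₀ i + E₁ i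
      split i = begin
        ⟦ hasParity o (suc (suc i)) ⟧ * weightSum 0# o k (suc i) * Wy (n ∸ suc i)
          ≈⟨ *-congʳ (*-cong (reflexive (≡.cong ⟦_⟧ (hasParity-suc o (suc i)))) (weightSum-suc 0# o k i)) ⟩
        e * (κ * a + b) * w
          ≈⟨ solve 5 (λ e κ a b w → e :* (κ :* a :+ b) :* w := κ :* (e :* a :* w) :+ e :* b :* w) refl e κ a b w ⟩
        κ * E₀ i + E₁ i ∎
        where
        e a b w : Carrier
        e = ⟦ hasParity (not o) (suc i) ⟧
        a = weightSum 0# (not o) 0 i
        b = weightSum 0# (not o) (suc k) i
        w = Wy (n ∸ suc i)

    -- Either S has no even element, or it is cut at the first one, a block end where the weight
    -- factorises.
    firstEven-decomposition : ∀ y o k n → weightSum y o k n ≈ weightSum 0# o k n + y * firstEvenSum y o k n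
    firstEven-decomposition y o k zero = begin
      weightSum y o k 0                        ≈⟨ weightSum-zero y o k ⟩
      ι (suc k)                                ≈⟨ weightSum-zero 0# o k ⟨
      weightSum 0# o k 0                       ≈⟨ +-identityʳ _ ⟨
      weightSum 0# o k 0 + 0#                  ≈⟨ +-congˡ (trans (*-congˡ (reflexive (∑<-empty _))) (zeroʳ y)) ⟨
      weightSum 0# o k 0 + y * firstEvenSum y o k 0 ∎
    firstEven-decomposition y true k (suc n) = begin
      weightSum y true k (suc n)
        ≈⟨ weightSum-suc y true k n ⟩
      ι (suc k) * x * weightSum y false 0 n + weightSum y false (suc k) n
        ≈⟨ +-cong (*-congˡ (firstEven-decomposition y false 0 n)) (firstEven-decomposition y false (suc k) n) ⟩
      ι (suc k) * x * (A₀ + y * E₀) + (A₁ + y * E₁)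
        ≈⟨ solve 8 (λ i x a₀ y e₀ a₁ e₁ w → i :* x :* (a₀ :+ y :* e₀) :+ (a₁ :+ y :* e₁)
                                          := i :* x :* a₀ :+ a₁ :+ y :* (con 0 :* i :* w :+ (i :* x :* e₀ :+ e₁)))
                 refl (ι (suc k)) x A₀ y E₀ A₁ E₁ (weightSum y true 0 n) ⟩
      ι (suc k) * x * A₀ + A₁ + y * (0# * ι (suc k) * weightSum y true 0 n + (ι (suc k) * x * E₀ + E₁))
        ≈⟨ +-cong (weightSum-suc 0# true k n) (*-congˡ (firstEvenSum-suc y true k n)) ⟨
      weightSum 0# true k (suc n) + y * firstEvenSum y true k (suc n) ∎
      where
      A₀ A₁ E₀ E₁ : Carrier
      A₀ = weightSum 0# false 0 n
      A₁ = weightSum 0# false (suc k) n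
      E₀ = firstEvenSum y false 0 n
      E₁ = firstEvenSum y false (suc k) n
    firstEven-decomposition y false k (suc n) = begin
      weightSum y false k (suc n)
        ≈⟨ weightSum-suc y false k n ⟩
      ι (suc k) * y * W + weightSum y true (suc k) n
        ≈⟨ +-congˡ (firstEven-decomposition y true (suc k) n) ⟩
      ι (suc k) * y * W + (A₁ + y * E₁)
        ≈⟨ solve 7 (λ i y w a₀ a₁ e₀ e₁ → i :* y :* w :+ (a₁ :+ y :* e₁)
                                        := i :* con 0 :* a₀ :+ a₁ :+ y :* (con 1 :* i :* w :+ (i :* con 0 :* e₀ :+ e₁)))
                 refl (ι (suc k)) y W A₀ A₁ E₀ E₁ ⟩
      ι (suc k) * 0# * A₀ + A₁ + y * (1# * ι (suc k) * W + (ι (suc k) * 0# * E₀ + E₁))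
        ≈⟨ +-cong (weightSum-suc 0# false k n) (*-congˡ (firstEvenSum-suc y false k n)) ⟨
      weightSum 0# false k (suc n) + y * firstEvenSum y false k (suc n) ∎
      where
      W A₀ A₁ E₀ E₁ : Carrier
      W = weightSum y true 0 n
      A₀ = weightSum 0# true 0 n
      A₁ = weightSum 0# true (suc k) n
      E₀ = firstEvenSum y true 0 n
      E₁ = firstEvenSum y true (suc k) n

    parityGF : Bool → Carrier → Series R
    parityGF e y zero    = 0#
    parityGF e y (suc n) = if hasParity e (suc n) then Ppoly R (suc n) x y q * ι (suc n) else 0#

    parityGF-suc : ∀ e y n → parityGF e y (suc n) ≈ ⟦ hasParity e (suc n) ⟧ * weightSum y true 0 n
    parityGF-suc e y n with hasParity e (suc n)
    ... | true  = trans (Ppoly-weightSum y n) (sym (*-identityˡ _))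
    ... | false = sym (zeroˡ _)

    ⟦⟧-guarded : ∀ a {b c} → (a ≡ true → b ≡ c) → ⟦ a ⟧ * ⟦ b ⟧ ≈ ⟦ a ⟧ * ⟦ c ⟧
    ⟦⟧-guarded true  b≡c = reflexive (≡.cong (λ b → 1# * ⟦ b ⟧) (b≡c ≡.refl))
    ⟦⟧-guarded false _   = trans (zeroˡ _) (sym (zeroˡ _))

    parityGF-recursion : ∀ e y → parityGF e y ≃ parityGF e 0# ⊕ scaleS R y (parityGF true 0#) ⊛ parityGF e y
    parityGF-recursion e y zero =
      sym (trans (+-identityˡ _) (trans (⊛-zero D G) (trans (*-congʳ (zeroʳ y)) (zeroˡ _))))
      where
      D G : Series R
      D = scaleS R y (parityGF true 0#)
      G = parityGF e y
    parityGF-recursion e y (suc n) = begin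
      G (suc n)
        ≈⟨ parityGF-suc e y n ⟩
      ⟦ p ⟧ * weightSum y true 0 n
        ≈⟨ *-congˡ (firstEven-decomposition y true 0 n) ⟩
      ⟦ p ⟧ * (weightSum 0# true 0 n + y * firstEvenSum y true 0 n)
        ≈⟨ distribˡ _ _ _ ⟩
      ⟦ p ⟧ * weightSum 0# true 0 n + ⟦ p ⟧ * (y * firstEvenSum y true 0 n)
        ≈⟨ +-cong (parityGF-suc e 0# n) (*-congˡ (∑<-*ˡ n y _)) ⟨
      parityGF e 0# (suc n) + ⟦ p ⟧ * ∑< n (λ i → y * term i)
        ≈⟨ +-congˡ (∑<-*ˡ n ⟦ p ⟧ _) ⟨
      parityGF e 0# (suc n) + ∑< n (λ i → ⟦ p ⟧ * (y * term i))
        ≈⟨ +-congˡ (∑<-cong n termwise) ⟩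
      parityGF e 0# (suc n) + ∑< n (λ i → D (suc i) * G (n ∸ i))
        ≈⟨ +-congˡ (⊛-suc-vanishing D G n (zeroʳ y) refl) ⟨
      parityGF e 0# (suc n) + (D ⊛ G) (suc n) ∎
      where
      D G : Series R
      D = scaleS R y (parityGF true 0#)
      G = parityGF e y
      p : Bool
      p = hasParity e (suc n)
      term : ℕ → Carrier
      term i = ⟦ isEvenᵇ (suc i) ⟧ * weightSum 0# true 0 i * weightSum y true 0 (n ∸ suc i)

      termwise : ∀ i → i < n → ⟦ p ⟧ * (y * term i) ≈ D (suc i) * G (n ∸ i)
      termwise i i<n = begin
        ⟦ p ⟧ * (y * (⟦ a ⟧ * A * B))
          ≈⟨ solve 5 (λ p y a u v → p :* (y :* (a :* u :* v)) := y :* u :* v :* (a :* p)) refl ⟦ p ⟧ y ⟦ a ⟧ A B ⟩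
        y * A * B * (⟦ a ⟧ * ⟦ p ⟧)
          ≡⟨ ≡.cong (λ m → y * A * B * (⟦ a ⟧ * ⟦ hasParity e m ⟧)) i+r≡n ⟨
        y * A * B * (⟦ a ⟧ * ⟦ hasParity e (suc i +ℕ suc r) ⟧)
          ≈⟨ *-congˡ (⟦⟧-guarded a (hasParity-even-shift e (suc i) (suc r))) ⟩
        y * A * B * (⟦ a ⟧ * ⟦ hasParity e (suc r) ⟧)
          ≈⟨ solve 5 (λ y u v a b → y :* u :* v :* (a :* b) := y :* (a :* u) :* (b :* v)) refl
                     y A B ⟦ a ⟧ ⟦ hasParity e (suc r) ⟧ ⟩
        y * (⟦ a ⟧ * A) * (⟦ hasParity e (suc r) ⟧ * B)
          ≈⟨ *-cong (*-congˡ (parityGF-suc true 0# i)) (parityGF-suc e y r) ⟨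
        D (suc i) * G (suc r)
          ≡⟨ ≡.cong (λ m → D (suc i) * G m) (≡.sym n∸i≡1+r) ⟩
        D (suc i) * G (n ∸ i) ∎
        where
        a : Bool
        a = isEvenᵇ (suc i)
        r : ℕ
        r = n ∸ suc i
        A B : Carrier
        A = weightSum 0# true 0 i
        B = weightSum y true 0 r
        n∸i≡1+r : n ∸ i ≡ suc r
        n∸i≡1+r = ℕ.+-∸-assoc 1 i<n
        i+r≡n : suc i +ℕ suc r ≡ suc n
        i+r≡n = ≡.trans (ℕ.+-suc (suc i) r) (≡.cong suc (ℕ.m+[n∸m]≡n i<n))

    evenGF≃parityGF : ∀ y → evenGF R x y q ι ≃ parityGF true y
    evenGF≃parityGF y zero    = refl
    evenGF≃parityGF y (suc n) = reflexive (≡.cong (λ b → if b then Ppoly R (suc n) x y q * ι (suc n) else 0#)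
                                                  (∧-identityʳ (isEvenᵇ (suc n))))

    oddGF≃parityGF : ∀ y → oddGF R x y q ι ≃ parityGF false y
    oddGF≃parityGF y zero    = refl
    oddGF≃parityGF y (suc n) = refl

    recursion-via-parityGF : ∀ {F F₀} e y → F ≃ parityGF e y → F₀ ≃ parityGF e 0# →
                          F ≃ F₀ ⊕ scaleS R y (evenGF R x 0# q ι) ⊛ F
    recursion-via-parityGF e y F≃ F₀≃ m = trans (F≃ m) (trans (parityGF-recursion e y m)
      (+-cong (sym (F₀≃ m)) (⊛-cong (λ k → *-congˡ (sym (evenGF≃parityGF 0# k))) (λ k → sym (F≃ k)) m)))

    evenGF-recursion : ∀ y →
      evenGF R x y q ι ≃ evenGF R x 0# q ι ⊕ scaleS R y (evenGF R x 0# q ι) ⊛ evenGF R x y q ι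
    evenGF-recursion y = recursion-via-parityGF true y (evenGF≃parityGF y) (evenGF≃parityGF 0#)

    oddGF-recursion : ∀ y →
      oddGF R x y q ι ≃ oddGF R x 0# q ι ⊕ scaleS R y (evenGF R x 0# q ι) ⊛ oddGF R x y q ι
    oddGF-recursion y = recursion-via-parityGF false y (oddGF≃parityGF y) (oddGF≃parityGF 0#)

lemma3p4 : ∀ {c ℓ} (R : CommutativeRing c ℓ) →
    let open CommutativeRing R in
    (x y q : Carrier) (ι : ℕ → Carrier) →
    (∀ n → qfact R q n * ι n ≈ 1#) →
    _≋_ R (evenGF R x y q ι)
          (_⋆_ R (evenGF R x 0# q ι) (invOneMinus R (scaleS R y (evenGF R x 0# q ι))))
    × _≋_ R (oddGF R x y q ι)
          (_⋆_ R (oddGF R x 0# q ι) (invOneMinus R (scaleS R y (evenGF R x 0# q ι))))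
lemma3p4 R x y q ι ι-inverse =
    linear-solution R yB yB₀≈0 (evenGF-recursion R x q ι ι-inverse y)
  , linear-solution R yB yB₀≈0 (oddGF-recursion R x q ι ι-inverse y)
  where
  open CommutativeRing R using (_≈_; 0#; zeroʳ)
  yB : Series R
  yB = scaleS R y (evenGF R x 0# q ι)
  yB₀≈0 : yB 0 ≈ 0#
  yB₀≈0 = zeroʳ y
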